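{- For every $n\ge1$, the optimal rubbling number of the path $P_n$ on $n$ vertices is $\rho_{\mathrm{opt}}(P_n)=\left\lceil\frac{n+1}{2}\right\rceil$.
   Context: A pebble distribution on a graph $G$ is a function $p:V(G)\to\mathbb{Z}_{\ge0}$, its size is $\sum_v p(v)$. If $\{v,u\}\in E(G)$, the pebbling move $(v,v\to u)$ removes two pebbles at $v$ and adds one at $u$. If $v\ne w$ and $\{v,u\},\{w,u\}\in E(G)$, the strict rubbling move $(v,w\to u)$ removes one pebble at each of $v$ and $w$ and adds one at $u$. A rubbling move is either of these. A vertex $x$ is reachable from $p$ if there is a sequence of rubbling moves, with pebble counts never becoming negative, after which $x$ has at least one pebble. The optimal rubbling number $\rho_{\mathrm{opt}}(G)$ is the minimum $m$ for which there exists a pebble distribution of size $m$ from which every vertex of $G$ is reachable. -}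

module Defs where

open import Data.Nat using (ℕ; zero; suc; _+_; _∸_; _≤_; _/_)
open import Data.Fin using (Fin; toℕ; _≟_)
open import Data.Product using (Σ; _×_; ∃)
open import Relation.Nullary using (¬_; yes; no)
open import Relation.Binary.PropositionalEquality using (_≡_)
open import Relation.Binary.Construct.Closure.ReflexiveTransitive using (Star)

-- A graph on the vertex set Fin n, given by its adjacency relation
-- (assumed symmetric and irreflexive for genuine simple graphs).
Graph : ℕ → Set₁
Graph n = Fin n → Fin n → Set

PathGraph : (n : ℕ) → Graph n
PathGraph n i j = (suc (toℕ i) ≡ toℕ j) Data.Sum.⊎ (suc (toℕ j) ≡ toℕ i)
  where import Data.Sum

Distribution : ℕ → Set
Distribution n = Fin n → ℕ

size : ∀ {n} → Distribution n → ℕ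
size {zero} p = 0
size {suc n} p = p Fin.zero + size (λ i → p (Fin.suc i))
  where import Data.Fin as Fin

remove : ∀ {n} → Fin n → ℕ → Distribution n → Distribution n
remove v k p x with x ≟ v
... | yes _ = p x ∸ k
... | no _ = p x

addOne : ∀ {n} → Fin n → Distribution n → Distribution n
addOne u p x with x ≟ u
... | yes _ = suc (p x)
... | no _ = p x

data RubblingMove {n} (G : Graph n) (p : Distribution n) : Distribution n → Set where
  pebbling : (v u : Fin n) → G v u → 2 ≤ p v →
             RubblingMove G p (addOne u (remove v 2 p))
  strict : (v w u : Fin n) → ¬ (v ≡ w) → G v u → G w u → 1 ≤ p v → 1 ≤ p w →
           RubblingMove G p (addOne u (remove w 1 (remove v 1 p)))

Reachable : ∀ {n} → Graph n → Distribution n → Fin n → Set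
Reachable G p x = Σ (Distribution _) λ q → Star (RubblingMove G) p q × 1 ≤ q x

AllReachable : ∀ {n} → Graph n → Distribution n → Set
AllReachable G p = ∀ x → Reachable G p x

IsOptimalRubblingNumber : ∀ {n} → Graph n → ℕ → Set
IsOptimalRubblingNumber G m =
  (Σ (Distribution _) λ p → size p ≡ m × AllReachable G p) ×
  (∀ p → AllReachable G p → m ≤ size p)

-- Read a distribution as the sequence q 0, …, q (n-1).  Pebbles can only reach a vertex x from its
-- two sides, and from the left at most  gather q x  pebbles can be piled on x - 1, where gather accumulates the
-- counts from vertex 0 on and halves the pile at every step to the right; symmetrically from the right.  Hence a
-- reachable x satisfies  2 q x + gather q x + gatherʳ q x ≥ 2,  and this condition, once it holds after a move,
-- already held before it.  Summing it over all vertices with an amortised count of the halving losses gives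
-- 2 |q| ≥ n + 1.
--
-- Upper bound.  One pebble on every even vertex and on the last vertex; every other vertex lies between two
-- pebbles and is reached by a single strict rubbling move.
module Submission where

open import Defs
open import Data.Nat using (ℕ; zero; suc; pred; _+_; _*_; _∸_; _/_; _≤_; _<_; _≤′_; ≤′-refl; ≤′-step; z≤n; s≤s; ⌊_/2⌋; ⌈_/2⌉)
open import Data.Nat.Properties
open import Data.Nat.DivMod using (m/n≡1+[m∸n]/n)
open import Data.Nat.Tactic.RingSolver using (solve-∀)
open import Data.Fin as Fin using (Fin; toℕ; fromℕ<)
open import Data.Fin.Properties using (toℕ-fromℕ<; toℕ<n; toℕ-injective)
open import Data.Product using (_,_)
open import Data.Sum using (_⊎_; inj₁; inj₂)
open import Data.Empty using (⊥-elim)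
open import Function using (_∘_; _$_)
open import Relation.Nullary using (yes; no)
open import Relation.Binary using (tri<; tri≈; tri>)
open import Relation.Binary.PropositionalEquality
open import Relation.Binary.Construct.Closure.ReflexiveTransitive using (Star; ε; _◅_)

⌊1+n/2⌋≤1+⌊n/2⌋ : ∀ n → ⌊ suc n /2⌋ ≤ suc ⌊ n /2⌋
⌊1+n/2⌋≤1+⌊n/2⌋ n = ⌊n/2⌋-mono (n≤1+n (suc n))

⌊n/2⌋+⌊n/2⌋≤n : ∀ n → ⌊ n /2⌋ + ⌊ n /2⌋ ≤ n
⌊n/2⌋+⌊n/2⌋≤n n = begin
  ⌊ n /2⌋ + ⌊ n /2⌋  ≤⟨ +-monoʳ-≤ ⌊ n /2⌋ (⌊n/2⌋≤⌈n/2⌉ n) ⟩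
  ⌊ n /2⌋ + ⌈ n /2⌉  ≡⟨ ⌊n/2⌋+⌈n/2⌉≡n n ⟩
  n                  ∎
  where open ≤-Reasoning

⌊n/2⌋+⌊n/2⌋≤pred[n+n] : ∀ n → ⌊ n /2⌋ + ⌊ n /2⌋ ≤ pred (n + n)
⌊n/2⌋+⌊n/2⌋≤pred[n+n] zero    = z≤n
⌊n/2⌋+⌊n/2⌋≤pred[n+n] (suc n) = ≤-trans (⌊n/2⌋+⌊n/2⌋≤n (suc n)) (m≤n+m (suc n) n)

n+pred[⌊n/2⌋+⌊n/2⌋]≤pred[n+n] : ∀ n → n + pred (⌊ n /2⌋ + ⌊ n /2⌋) ≤ pred (n + n)
n+pred[⌊n/2⌋+⌊n/2⌋]≤pred[n+n] zero    = z≤n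
n+pred[⌊n/2⌋+⌊n/2⌋]≤pred[n+n] (suc n) = begin
  suc n + pred (⌊ suc n /2⌋ + ⌊ suc n /2⌋)  ≤⟨ +-monoʳ-≤ (suc n) (pred-mono-≤ (⌊n/2⌋+⌊n/2⌋≤n (suc n))) ⟩
  suc n + n                                  ≡⟨ +-comm (suc n) n ⟩
  n + suc n                                  ∎
  where open ≤-Reasoning

⌊1+n+n/2⌋≡n : ∀ n → ⌊ suc (n + n) /2⌋ ≡ n
⌊1+n+n/2⌋≡n zero    = refl
⌊1+n+n/2⌋≡n (suc n) rewrite +-suc n n = cong suc (⌊1+n+n/2⌋≡n n)

⌊n/2⌋≡n/2 : ∀ n → ⌊ n /2⌋ ≡ n / 2
⌊n/2⌋≡n/2 zero          = refl
⌊n/2⌋≡n/2 (suc zero)    = refl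
⌊n/2⌋≡n/2 (suc (suc n)) = trans (cong suc (⌊n/2⌋≡n/2 n)) (sym (m/n≡1+[m∸n]/n {suc (suc n)} {2} (s≤s (s≤s z≤n))))

m+m≤n+n⇒m≤n : ∀ {m n} → m + m ≤ n + n → m ≤ n
m+m≤n+n⇒m≤n {m} {n} le = subst₂ _≤_ (sym (n≡⌊n+n/2⌋ m)) (sym (n≡⌊n+n/2⌋ n)) (⌊n/2⌋-mono le)

sumBelow : ℕ → (ℕ → ℕ) → ℕ
sumBelow zero    f = 0
sumBelow (suc n) f = f 0 + sumBelow n (f ∘ suc)

sumBelow-suc : ∀ n f → sumBelow (suc n) f ≡ sumBelow n f + f n
sumBelow-suc zero    f = +-comm (f 0) 0
sumBelow-suc (suc n) f rewrite sumBelow-suc n (f ∘ suc) = sym (+-assoc (f 0) _ _)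

sumBelow-cong : ∀ n {f g} → (∀ i → i < n → f i ≡ g i) → sumBelow n f ≡ sumBelow n g
sumBelow-cong zero    eq = refl
sumBelow-cong (suc n) eq = cong₂ _+_ (eq 0 (s≤s z≤n)) (sumBelow-cong n (λ i i<n → eq (suc i) (s≤s i<n)))

*≤sumBelow : ∀ n {c f} → (∀ i → i < n → c ≤ f i) → n * c ≤ sumBelow n f
*≤sumBelow zero    le = z≤n
*≤sumBelow (suc n) le = +-mono-≤ (le 0 (s≤s z≤n)) (*≤sumBelow n (λ i i<n → le (suc i) (s≤s i<n)))

sumBelow-distrib-+ : ∀ n f g → sumBelow n (λ i → f i + g i) ≡ sumBelow n f + sumBelow n g
sumBelow-distrib-+ zero    f g = refl
sumBelow-distrib-+ (suc n) f g rewrite sumBelow-distrib-+ n (f ∘ suc) (g ∘ suc) = shuffle (f 0) (g 0) _ _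
  where
  shuffle : ∀ a b c d → a + b + (c + d) ≡ a + c + (b + d)
  shuffle = solve-∀

mirror : ℕ → ℕ → ℕ
mirror n j = n ∸ suc j

reflect : ℕ → (ℕ → ℕ) → ℕ → ℕ
reflect n q = q ∘ mirror n

mirror-< : ∀ {n j} → j < n → mirror n j < n
mirror-< {suc n} {j} _ = s≤s (m∸n≤m n j)

mirror-involutive : ∀ {n j} → j < n → mirror n (mirror n j) ≡ j
mirror-involutive {suc n} (s≤s j≤n) = m∸[m∸n]≡n j≤n

mirror-anti : ∀ {n j k} → j < k → k < n → mirror n k < mirror n j
mirror-anti {n} j<k k<n = ∸-monoʳ-< {m = n} (s≤s j<k) k<n

mirror-suc : ∀ {n j} → suc j < n → mirror n j ≡ suc (mirror n (suc j))
mirror-suc {suc n} {j} (s≤s 1+j≤n) = +-∸-assoc 1 {n} {suc j} 1+j≤n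

sumBelow-reflect : ∀ n f → sumBelow n (reflect n f) ≡ sumBelow n f
sumBelow-reflect zero    f = refl
sumBelow-reflect (suc n) f = begin
  f n + sumBelow n (reflect n f)  ≡⟨ cong (f n +_) (sumBelow-reflect n f) ⟩
  f n + sumBelow n f              ≡⟨ +-comm (f n) _ ⟩
  sumBelow n f + f n              ≡⟨ sumBelow-suc n f ⟨
  sumBelow (suc n) f              ∎
  where open ≡-Reasoning

gather : (ℕ → ℕ) → ℕ → ℕ
gather q zero    = 0
gather q (suc x) = q x + ⌊ gather q x /2⌋

gatherʳ : ℕ → (ℕ → ℕ) → ℕ → ℕ
gatherʳ n q x = gather (reflect n q) (mirror n x)

gather-mono-from : ∀ {q r a x} → a ≤′ x → gather r a ≤ gather q a →
                   (∀ j → a ≤ j → j < x → r j ≤ q j) → gather r x ≤ gather q x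
gather-mono-from ≤′-refl             base le = base
gather-mono-from (≤′-step {x} a≤′x) base le =
  +-mono-≤ (le x (≤′⇒≤ a≤′x) ≤-refl)
           (⌊n/2⌋-mono (gather-mono-from a≤′x base (λ j a≤j j<x → le j a≤j (m≤n⇒m≤1+n j<x))))

gather-mono : ∀ {q r} x → (∀ j → j < x → r j ≤ q j) → gather r x ≤ gather q x
gather-mono x le = gather-mono-from (≤⇒≤′ z≤n) ≤-refl (λ j _ → le j)

gatherʳ-suc : ∀ {n} q x → suc x < n → gatherʳ n q x ≡ q (suc x) + ⌊ gatherʳ n q (suc x) /2⌋
gatherʳ-suc {n} q x 1+x<n = begin
  gather (reflect n q) (mirror n x)
    ≡⟨ cong (gather (reflect n q)) (mirror-suc 1+x<n) ⟩
  q (mirror n (mirror n (suc x))) + ⌊ gatherʳ n q (suc x) /2⌋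
    ≡⟨ cong (λ y → q y + ⌊ gatherʳ n q (suc x) /2⌋) (mirror-involutive 1+x<n) ⟩
  q (suc x) + ⌊ gatherʳ n q (suc x) /2⌋
    ∎
  where open ≡-Reasoning

record Covered (n : ℕ) (q : ℕ → ℕ) (x : ℕ) : Set where
  constructor covered
  field
    pebbles-nearby : 2 ≤ (q x + q x) + (gather q x + gatherʳ n q x)

covered-by-pebble : ∀ {n q x} → 1 ≤ q x → Covered n q x
covered-by-pebble {q = q} {x} 1≤qx = covered $ ≤-trans (+-mono-≤ 1≤qx 1≤qx) (m≤m+n (q x + q x) _)

covered-by-left : ∀ {n q x} → 2 ≤ gather q x → Covered n q x
covered-by-left {n} {q} {x} le = covered $ ≤-trans le (≤-trans (m≤m+n _ (gatherʳ n q x)) (m≤n+m _ (q x + q x)))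

covered-by-right : ∀ {n q x} → 2 ≤ gatherʳ n q x → Covered n q x
covered-by-right {n} {q} {x} le = covered $ ≤-trans le (≤-trans (m≤n+m _ (gather q x)) (m≤n+m _ (q x + q x)))

covered-by-both : ∀ {n q x} → 1 ≤ gather q x → 1 ≤ gatherʳ n q x → Covered n q x
covered-by-both {q = q} {x} le le′ = covered $ ≤-trans (+-mono-≤ le le′) (m≤n+m _ (q x + q x))

-- Counting: every covered vertex earns two credits, and the credits cost at most 2 |q| - 1 from each side

credit : ℕ → ℕ → ℕ
credit zero    g = g
credit (suc _) g = 1

creditˡ : (ℕ → ℕ) → ℕ → ℕ
creditˡ q x = credit (q x) (gather q x)

creditʳ : ℕ → (ℕ → ℕ) → ℕ → ℕ
creditʳ n q x = credit (q x) (gatherʳ n q x)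

covered⇒two-credits : ∀ {n q x} → Covered n q x → 2 ≤ creditˡ q x + creditʳ n q x
covered⇒two-credits {q = q} {x} (covered enough) with q x
... | zero  = enough
... | suc _ = ≤-refl

-- The slack  pred (2 · gather q j)  carries the pebbles gathered so far, which pay for the credits of the
-- following empty vertices.
sumBelow-creditˡ-amortised : ∀ q j → sumBelow j (creditˡ q) + pred (gather q j + gather q j) ≤ sumBelow j q + sumBelow j q
sumBelow-creditˡ-amortised q zero = z≤n
sumBelow-creditˡ-amortised q (suc j) rewrite sumBelow-suc j (creditˡ q) | sumBelow-suc j q with q j | sumBelow-creditˡ-amortised q j
... | zero | ih = begin
  C + g + pred (⌊ g /2⌋ + ⌊ g /2⌋)    ≡⟨ +-assoc C g _ ⟩
  C + (g + pred (⌊ g /2⌋ + ⌊ g /2⌋))  ≤⟨ +-monoʳ-≤ C (n+pred[⌊n/2⌋+⌊n/2⌋]≤pred[n+n] g) ⟩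
  C + pred (g + g)                     ≤⟨ ih ⟩
  Q + Q                                ≡⟨ cong₂ _+_ (+-identityʳ Q) (+-identityʳ Q) ⟨
  Q + 0 + (Q + 0)                      ∎
  where
  open ≤-Reasoning
  C = sumBelow j (creditˡ q)
  Q = sumBelow j q
  g = gather q j
... | suc k | ih = begin
  C + 1 + pred (suc k + h + (suc k + h))  ≡⟨ regroup C k h ⟩
  C + (h + h) + (suc k + suc k)           ≤⟨ +-monoˡ-≤ (suc k + suc k) (+-monoʳ-≤ C (⌊n/2⌋+⌊n/2⌋≤pred[n+n] g)) ⟩
  C + pred (g + g) + (suc k + suc k)      ≤⟨ +-monoˡ-≤ (suc k + suc k) ih ⟩
  Q + Q + (suc k + suc k)                 ≡⟨ exchange Q (suc k) ⟩
  Q + suc k + (Q + suc k)                 ∎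
  where
  open ≤-Reasoning
  C = sumBelow j (creditˡ q)
  Q = sumBelow j q
  g = gather q j
  h = ⌊ g /2⌋
  regroup : ∀ C k h → C + 1 + (k + h + (suc k + h)) ≡ C + (h + h) + (suc k + suc k)
  regroup = solve-∀
  exchange : ∀ Q k → Q + Q + (k + k) ≡ Q + k + (Q + k)
  exchange = solve-∀

sumBelow-creditʳ : ∀ n q → sumBelow n (creditʳ n q) ≡ sumBelow n (creditˡ (reflect n q))
sumBelow-creditʳ n q = begin
  sumBelow n (creditʳ n q)               ≡⟨ sumBelow-reflect n (creditʳ n q) ⟨
  sumBelow n (reflect n (creditʳ n q))   ≡⟨ sumBelow-cong n (λ i i<n → cong (credit (q (mirror n i)) ∘ gather (reflect n q)) (mirror-involutive i<n)) ⟩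
  sumBelow n (creditˡ (reflect n q))     ∎
  where open ≡-Reasoning

sumBelow-creditˡ<sumBelow+sumBelow : ∀ q n → 1 ≤ gather q n → sumBelow n (creditˡ q) + 1 ≤ sumBelow n q + sumBelow n q
sumBelow-creditˡ<sumBelow+sumBelow q n 1≤g = ≤-trans (+-monoʳ-≤ (sumBelow n (creditˡ q)) (pred-double (gather q n) 1≤g)) (sumBelow-creditˡ-amortised q n)
  where
  pred-double : ∀ g → 1 ≤ g → 1 ≤ pred (g + g)
  pred-double (suc g) _ = subst (1 ≤_) (sym (+-suc g g)) (s≤s z≤n)

covered-last⇒gather : ∀ m q → Covered (suc m) q m → 1 ≤ gather q (suc m)
covered-last⇒gather m q (covered enough) with q m
... | suc _ = s≤s z≤n
... | zero rewrite n∸n≡0 m = ⌊n/2⌋-mono {2} (subst (2 ≤_) (+-identityʳ (gather q m)) enough)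

covered-first⇒gatherʳ : ∀ m q → Covered (suc m) q 0 → 1 ≤ gather (reflect (suc m) q) (suc m)
covered-first⇒gatherʳ m q (covered enough) rewrite n∸n≡0 m with q 0
... | suc _ = s≤s z≤n
... | zero  = ⌊n/2⌋-mono {2} enough

all-covered⇒1+n≤size+size : ∀ n q → 1 ≤ n → (∀ x → x < n → Covered n q x) → suc n ≤ sumBelow n q + sumBelow n q
all-covered⇒1+n≤size+size (suc m) q _ cov = m+m≤n+n⇒m≤n (begin
  suc n + suc n             ≡⟨ regroup n ⟩
  n * 2 + 2                 ≤⟨ +-monoˡ-≤ 2 pairs ⟩
  Cˡ + Cʳ + 2               ≡⟨ regroup′ Cˡ Cʳ ⟩
  (Cˡ + 1) + (Cʳ + 1)       ≤⟨ +-mono-≤ left right ⟩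
  (Q + Q) + (Q + Q)         ∎)
  where
  open ≤-Reasoning
  n  = suc m
  Q  = sumBelow n q
  Cˡ = sumBelow n (creditˡ q)
  Cʳ = sumBelow n (creditʳ n q)
  pairs : n * 2 ≤ Cˡ + Cʳ
  pairs = subst (n * 2 ≤_) (sumBelow-distrib-+ n (creditˡ q) (creditʳ n q))
                (*≤sumBelow n (λ x x<n → covered⇒two-credits (cov x x<n)))
  left : Cˡ + 1 ≤ Q + Q
  left = sumBelow-creditˡ<sumBelow+sumBelow q n (covered-last⇒gather m q (cov m ≤-refl))
  right : Cʳ + 1 ≤ Q + Q
  right = subst₂ (λ c s → c + 1 ≤ s + s) (sym (sumBelow-creditʳ n q)) (sumBelow-reflect n q)
                 (sumBelow-creditˡ<sumBelow+sumBelow (reflect n q) n (covered-first⇒gatherʳ m q (cov 0 (s≤s z≤n))))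
  regroup : ∀ n → suc n + suc n ≡ n * 2 + 2
  regroup = solve-∀
  regroup′ : ∀ a b → a + b + 2 ≡ a + 1 + (b + 1)
  regroup′ = solve-∀

record GainsAtMostOneAt (n : ℕ) (q r : ℕ → ℕ) (t : ℕ) : Set where
  field
    at-target : r t ≤ suc (q t)
    elsewhere : ∀ j → j < n → j ≢ t → r j ≤ q j

open GainsAtMostOneAt

-- Only the inequalities needed by the invariant are recorded; a in each case is the leftmost vertex involved.
data Step (n : ℕ) (q r : ℕ → ℕ) : Set where
  rightward : ∀ a → suc a < n → 2 + r a ≤ q a → GainsAtMostOneAt n q r (suc a) → Step n q r
  leftward  : ∀ a → suc a < n → 2 + r (suc a) ≤ q (suc a) → GainsAtMostOneAt n q r a → Step n q r
  strict    : ∀ a → suc (suc a) < n → 1 + r a ≤ q a → 1 + r (suc (suc a)) ≤ q (suc (suc a)) →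
              GainsAtMostOneAt n q r (suc a) → Step n q r

module _ {n : ℕ} {q r : ℕ → ℕ} where

  lo hi target : Step n q r → ℕ
  lo (rightward a _ _ _)     = a
  lo (leftward a _ _ _)      = a
  lo (strict a _ _ _ _)      = a
  hi (rightward a _ _ _)     = suc a
  hi (leftward a _ _ _)      = suc a
  hi (strict a _ _ _ _)      = suc (suc a)
  target (rightward a _ _ _) = suc a
  target (leftward a _ _ _)  = a
  target (strict a _ _ _ _)  = suc a

  gains : (s : Step n q r) → GainsAtMostOneAt n q r (target s)
  gains (rightward _ _ _ g) = g
  gains (leftward _ _ _ g)  = g
  gains (strict _ _ _ _ g)  = g

  lo≤target : (s : Step n q r) → lo s ≤ target s
  lo≤target (rightward a _ _ _) = n≤1+n a
  lo≤target (leftward a _ _ _)  = ≤-refl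
  lo≤target (strict a _ _ _ _)  = n≤1+n a

  target≤hi : (s : Step n q r) → target s ≤ hi s
  target≤hi (rightward a _ _ _) = ≤-refl
  target≤hi (leftward a _ _ _)  = n≤1+n a
  target≤hi (strict a _ _ _ _)  = n≤1+n (suc a)

  hi<n : (s : Step n q r) → hi s < n
  hi<n (rightward _ a<n _ _) = a<n
  hi<n (leftward _ a<n _ _)  = a<n
  hi<n (strict _ a<n _ _ _)  = a<n

  Outside : Step n q r → ℕ → Set
  Outside s x = x < lo s ⊎ hi s < x

  outside⇒≢target : (s : Step n q r) → ∀ {x} → Outside s x → x ≢ target s
  outside⇒≢target s (inj₁ x<lo) refl = <⇒≱ x<lo (lo≤target s)
  outside⇒≢target s (inj₂ hi<x) refl = <⇒≱ hi<x (target≤hi s)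

  gather-below : (s : Step n q r) → ∀ x → x ≤ target s → gather r x ≤ gather q x
  gather-below s x x≤t = gather-mono x (λ j j<x →
    elsewhere (gains s) j (<-trans (<-≤-trans j<x x≤t) (<-≤-trans (s≤s (target≤hi s)) (hi<n s))) (<⇒≢ (<-≤-trans j<x x≤t)))

  gather-past-window : (s : Step n q r) → gather r (suc (hi s)) ≤ gather q (suc (hi s))
  gather-past-window s@(rightward a _ source g) = begin
    r (suc a) + ⌊ r a + G /2⌋          ≤⟨ +-monoˡ-≤ _ (at-target g) ⟩
    suc (q (suc a)) + ⌊ r a + G /2⌋    ≡⟨ +-suc (q (suc a)) _ ⟨
    q (suc a) + ⌊ 2 + r a + G /2⌋      ≤⟨ +-monoʳ-≤ (q (suc a)) (⌊n/2⌋-mono (+-mono-≤ source G≤G′)) ⟩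
    q (suc a) + ⌊ q a + G′ /2⌋         ∎
    where
    open ≤-Reasoning
    G  = ⌊ gather r a /2⌋
    G′ = ⌊ gather q a /2⌋
    G≤G′ : G ≤ G′
    G≤G′ = ⌊n/2⌋-mono (gather-below s a (lo≤target s))
  gather-past-window s@(leftward a _ source g) = begin
    r (suc a) + ⌊ r a + G /2⌋          ≤⟨ +-monoʳ-≤ (r (suc a)) (⌊n/2⌋-mono (+-mono-≤ (at-target g) G≤G′)) ⟩
    r (suc a) + ⌊ suc (q a + G′) /2⌋   ≤⟨ +-monoʳ-≤ (r (suc a)) (⌊1+n/2⌋≤1+⌊n/2⌋ (q a + G′)) ⟩
    r (suc a) + suc ⌊ q a + G′ /2⌋     ≡⟨ +-suc (r (suc a)) _ ⟩
    suc (r (suc a)) + ⌊ q a + G′ /2⌋   ≤⟨ +-monoˡ-≤ _ (≤-trans (n≤1+n _) source) ⟩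
    q (suc a) + ⌊ q a + G′ /2⌋         ∎
    where
    open ≤-Reasoning
    G  = ⌊ gather r a /2⌋
    G′ = ⌊ gather q a /2⌋
    G≤G′ : G ≤ G′
    G≤G′ = ⌊n/2⌋-mono (gather-below s a (lo≤target s))
  gather-past-window s@(strict a _ source₁ source₂ g) = begin
    r (suc (suc a)) + ⌊ r (suc a) + ⌊ r a + ⌊ gather r a /2⌋ /2⌋ /2⌋
      ≤⟨ +-monoʳ-≤ (r (suc (suc a))) (⌊n/2⌋-mono (+-mono-≤ (at-target g) inner)) ⟩
    r (suc (suc a)) + ⌊ suc (q (suc a) + H′) /2⌋
      ≤⟨ +-monoʳ-≤ (r (suc (suc a))) (⌊1+n/2⌋≤1+⌊n/2⌋ (q (suc a) + H′)) ⟩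
    r (suc (suc a)) + suc ⌊ q (suc a) + H′ /2⌋
      ≡⟨ +-suc (r (suc (suc a))) _ ⟩
    suc (r (suc (suc a))) + ⌊ q (suc a) + H′ /2⌋
      ≤⟨ +-monoˡ-≤ _ source₂ ⟩
    q (suc (suc a)) + ⌊ q (suc a) + H′ /2⌋
      ∎
    where
    open ≤-Reasoning
    H′ = ⌊ q a + ⌊ gather q a /2⌋ /2⌋
    inner : ⌊ r a + ⌊ gather r a /2⌋ /2⌋ ≤ H′
    inner = ⌊n/2⌋-mono (+-mono-≤ (≤-trans (n≤1+n _) source₁) (⌊n/2⌋-mono (gather-below s a (lo≤target s))))

  gather-outside : (s : Step n q r) → ∀ {x} → x ≤ n → Outside s x → gather r x ≤ gather q x
  gather-outside s {x} _   (inj₁ x<lo) = gather-below s x (≤-trans (<⇒≤ x<lo) (lo≤target s))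
  gather-outside s {x} x≤n (inj₂ hi<x) = gather-mono-from (≤⇒≤′ hi<x) (gather-past-window s) (λ j hi<j j<x →
    elsewhere (gains s) j (<-≤-trans j<x x≤n) (>⇒≢ (≤-<-trans (target≤hi s) hi<j)))

module _ {n : ℕ} {q r : ℕ → ℕ} where

  reflect-gains : ∀ {t} → t < n → GainsAtMostOneAt n q r t → GainsAtMostOneAt n (reflect n q) (reflect n r) (mirror n t)
  reflect-gains t<n g .at-target =
    subst (λ y → r y ≤ suc (q y)) (sym (mirror-involutive t<n)) (at-target g)
  reflect-gains t<n g .elsewhere j j<n j≢t′ =
    elsewhere g (mirror n j) (mirror-< j<n) (λ j′≡t → j≢t′ (trans (sym (mirror-involutive j<n)) (cong (mirror n) j′≡t)))

  reflect-step : Step n q r → Step n (reflect n q) (reflect n r)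
  reflect-step (rightward a 1+a<n source g) =
    leftward (mirror n (suc a)) (subst (_< n) (mirror-suc 1+a<n) (mirror-< a<n))
      (subst (λ y → 2 + r y ≤ q y) (sym (trans (cong (mirror n) (sym (mirror-suc 1+a<n))) (mirror-involutive a<n))) source)
      (reflect-gains 1+a<n g)
    where a<n = <-trans (n<1+n a) 1+a<n
  reflect-step (leftward a 1+a<n source g) =
    rightward (mirror n (suc a)) (subst (_< n) (mirror-suc 1+a<n) (mirror-< a<n))
      (subst (λ y → 2 + r y ≤ q y) (sym (mirror-involutive 1+a<n)) source)
      (subst (GainsAtMostOneAt n (reflect n q) (reflect n r)) (mirror-suc 1+a<n) (reflect-gains a<n g))
    where a<n = <-trans (n<1+n a) 1+a<n
  reflect-step (strict a 2+a<n source₁ source₂ g) =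
    strict (mirror n (suc (suc a))) (subst (_< n) (sym 2+b≡mirror-a) (mirror-< a<n))
      (subst (λ y → 1 + r y ≤ q y) (sym (mirror-involutive 2+a<n)) source₂)
      (subst (λ y → 1 + r y ≤ q y) (sym (trans (cong (mirror n) 2+b≡mirror-a) (mirror-involutive a<n))) source₁)
      (subst (GainsAtMostOneAt n (reflect n q) (reflect n r)) (mirror-suc 2+a<n) (reflect-gains 1+a<n g))
    where
    1+a<n = <-trans (n<1+n (suc a)) 2+a<n
    a<n   = <-trans (n<1+n a) 1+a<n
    2+b≡mirror-a : suc (suc (mirror n (suc (suc a)))) ≡ mirror n a
    2+b≡mirror-a = sym (trans (mirror-suc 1+a<n) (cong suc (mirror-suc 2+a<n)))

  lo-reflect : (s : Step n q r) → lo (reflect-step s) ≡ mirror n (hi s)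
  lo-reflect (rightward _ _ _ _) = refl
  lo-reflect (leftward _ _ _ _)  = refl
  lo-reflect (strict _ _ _ _ _)  = refl

  hi-reflect : (s : Step n q r) → hi (reflect-step s) ≡ mirror n (lo s)
  hi-reflect (rightward a 1+a<n _ _) = sym (mirror-suc 1+a<n)
  hi-reflect (leftward a 1+a<n _ _)  = sym (mirror-suc 1+a<n)
  hi-reflect (strict a 2+a<n _ _ _)  =
    sym (trans (mirror-suc (<-trans (n<1+n (suc a)) 2+a<n)) (cong suc (mirror-suc 2+a<n)))

  outside-reflect : (s : Step n q r) → ∀ {x} → x < n → Outside s x → Outside (reflect-step s) (mirror n x)
  outside-reflect s x<n (inj₁ x<lo) =
    inj₂ (subst (_< mirror n _) (sym (hi-reflect s)) (mirror-anti x<lo (≤-<-trans (lo≤target s) (≤-<-trans (target≤hi s) (hi<n s)))))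
  outside-reflect s x<n (inj₂ hi<x) =
    inj₁ (subst (mirror n _ <_) (sym (lo-reflect s)) (mirror-anti hi<x x<n))

  gatherʳ-outside : (s : Step n q r) → ∀ {x} → x < n → Outside s x → gatherʳ n r x ≤ gatherʳ n q x
  gatherʳ-outside s x<n out = gather-outside (reflect-step s) (<⇒≤ (mirror-< x<n)) (outside-reflect s x<n out)

  window : (s : Step n q r) → ∀ x → Outside s x ⊎ x ≡ target s ⊎ 1 ≤ q x
  window (rightward a _ source _) x with <-cmp x a
  ... | tri< x<a _ _ = inj₁ (inj₁ x<a)
  ... | tri≈ _ refl _ = inj₂ (inj₂ (≤-trans (s≤s z≤n) source))
  ... | tri> _ _ a<x with m≤n⇒m<n∨m≡n a<x
  ...   | inj₁ 1+a<x = inj₁ (inj₂ 1+a<x)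
  ...   | inj₂ refl  = inj₂ (inj₁ refl)
  window (leftward a _ source _) x with <-cmp x a
  ... | tri< x<a _ _ = inj₁ (inj₁ x<a)
  ... | tri≈ _ refl _ = inj₂ (inj₁ refl)
  ... | tri> _ _ a<x with m≤n⇒m<n∨m≡n a<x
  ...   | inj₁ 1+a<x = inj₁ (inj₂ 1+a<x)
  ...   | inj₂ refl  = inj₂ (inj₂ (≤-trans (s≤s z≤n) source))
  window (strict a _ source₁ source₂ _) x with <-cmp x a
  ... | tri< x<a _ _ = inj₁ (inj₁ x<a)
  ... | tri≈ _ refl _ = inj₂ (inj₂ (≤-trans (s≤s z≤n) source₁))
  ... | tri> _ _ a<x with m≤n⇒m<n∨m≡n a<x
  ...   | inj₂ refl  = inj₂ (inj₁ refl)
  ...   | inj₁ 1+a<x with m≤n⇒m<n∨m≡n 1+a<x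
  ...     | inj₁ 2+a<x = inj₁ (inj₂ 2+a<x)
  ...     | inj₂ refl  = inj₂ (inj₂ (≤-trans (s≤s z≤n) source₂))

  covered-at-target : (s : Step n q r) → Covered n q (target s)
  covered-at-target (rightward a _ source _) =
    covered-by-left (≤-trans (m+n≤o⇒m≤o 2 source) (m≤m+n (q a) _))
  covered-at-target (leftward a 1+a<n source _) =
    covered-by-right (subst (2 ≤_) (sym (gatherʳ-suc {n} q a 1+a<n)) (≤-trans (m+n≤o⇒m≤o 2 source) (m≤m+n _ _)))
  covered-at-target (strict a 2+a<n source₁ source₂ _) =
    covered-by-both (≤-trans (m+n≤o⇒m≤o 1 source₁) (m≤m+n (q a) _))
                    (subst (1 ≤_) (sym (gatherʳ-suc {n} q (suc a) 2+a<n)) (≤-trans (m+n≤o⇒m≤o 1 source₂) (m≤m+n _ _)))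

  covered-backward : Step n q r → ∀ {x} → x < n → Covered n r x → Covered n q x
  covered-backward s {x} x<n (covered enough) with window s x
  ... | inj₂ (inj₁ refl)  = covered-at-target s
  ... | inj₂ (inj₂ 1≤qx)  = covered-by-pebble 1≤qx
  ... | inj₁ out          = covered $ ≤-trans enough (+-mono-≤ (+-mono-≤ rx≤qx rx≤qx)
                                                  (+-mono-≤ (gather-outside s (<⇒≤ x<n) out) (gatherʳ-outside s x<n out)))
    where
    rx≤qx : r x ≤ q x
    rx≤qx = elsewhere (gains s) x x<n (outside⇒≢target s out)

extend : ∀ {n} → Distribution n → ℕ → ℕ
extend {zero}  p _       = 0
extend {suc n} p zero    = p Fin.zero
extend {suc n} p (suc j) = extend (p ∘ Fin.suc) j

extend-toℕ : ∀ {n} (p : Distribution n) (k : Fin n) → extend p (toℕ k) ≡ p k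
extend-toℕ {suc n} p Fin.zero    = refl
extend-toℕ {suc n} p (Fin.suc k) = extend-toℕ (p ∘ Fin.suc) k

extend-fromℕ< : ∀ {n j} (p : Distribution n) (j<n : j < n) → extend p j ≡ p (fromℕ< j<n)
extend-fromℕ< p j<n = trans (cong (extend p) (sym (toℕ-fromℕ< j<n))) (extend-toℕ p _)

size≡sumBelow : ∀ {n} (p : Distribution n) → size p ≡ sumBelow n (extend p)
size≡sumBelow {zero}  p = refl
size≡sumBelow {suc n} p = cong (p Fin.zero +_) (size≡sumBelow (p ∘ Fin.suc))

addOne-≡ : ∀ {n} (u : Fin n) p → addOne u p u ≡ suc (p u)
addOne-≡ u p with u Fin.≟ u
... | yes _  = refl
... | no u≢u = ⊥-elim (u≢u refl)

addOne-≢ : ∀ {n} (u : Fin n) p {x} → x ≢ u → addOne u p x ≡ p x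
addOne-≢ u p {x} x≢u with x Fin.≟ u
... | yes x≡u = ⊥-elim (x≢u x≡u)
... | no _    = refl

remove-≢ : ∀ {n} (v : Fin n) k p {x} → x ≢ v → remove v k p x ≡ p x
remove-≢ v k p {x} x≢v with x Fin.≟ v
... | yes x≡v = ⊥-elim (x≢v x≡v)
... | no _    = refl

remove-≤ : ∀ {n} (v : Fin n) k p x → remove v k p x ≤ p x
remove-≤ v k p x with x Fin.≟ v
... | yes _ = m∸n≤m (p x) k
... | no _  = ≤-refl

remove-+ : ∀ {n} (v : Fin n) k p → k ≤ p v → k + remove v k p v ≡ p v
remove-+ v k p k≤pv with v Fin.≟ v
... | yes _  = m+[n∸m]≡n k≤pv
... | no v≢v = ⊥-elim (v≢v refl)

adjacent⇒≢ : ∀ {n} {v u : Fin n} → suc (toℕ v) ≡ toℕ u → v ≢ u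
adjacent⇒≢ e refl = 1+n≢n e

module _ {n : ℕ} (p : Distribution n) where

  addOne-gains : ∀ u (p′ : Distribution n) → (∀ x → p′ x ≤ p x) →
                 GainsAtMostOneAt n (extend p) (extend (addOne u p′)) (toℕ u)
  addOne-gains u p′ p′≤p .at-target
    rewrite extend-toℕ (addOne u p′) u | extend-toℕ p u | addOne-≡ u p′ = s≤s (p′≤p u)
  addOne-gains u p′ p′≤p .elsewhere j j<n j≢u
    rewrite extend-fromℕ< (addOne u p′) j<n | extend-fromℕ< p j<n =
    ≤-trans (≤-reflexive (addOne-≢ u p′ (λ k≡u → j≢u (trans (sym (toℕ-fromℕ< j<n)) (cong toℕ k≡u))))) (p′≤p _)

  pebbling-source : ∀ v u → v ≢ u → 2 ≤ p v → 2 + extend (addOne u (remove v 2 p)) (toℕ v) ≤ extend p (toℕ v)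
  pebbling-source v u v≢u 2≤pv rewrite extend-toℕ (addOne u (remove v 2 p)) v | extend-toℕ p v | addOne-≢ u (remove v 2 p) v≢u =
    ≤-reflexive (remove-+ v 2 p 2≤pv)

  strict-source₁ : ∀ v w u → v ≢ u → 1 ≤ p v →
                   1 + extend (addOne u (remove w 1 (remove v 1 p))) (toℕ v) ≤ extend p (toℕ v)
  strict-source₁ v w u v≢u 1≤pv
    rewrite extend-toℕ (addOne u (remove w 1 (remove v 1 p))) v | extend-toℕ p v | addOne-≢ u (remove w 1 (remove v 1 p)) v≢u =
    ≤-trans (s≤s (remove-≤ w 1 (remove v 1 p) v)) (≤-reflexive (remove-+ v 1 p 1≤pv))

  strict-source₂ : ∀ v w u → w ≢ u → w ≢ v → 1 ≤ p w →
                   1 + extend (addOne u (remove w 1 (remove v 1 p))) (toℕ w) ≤ extend p (toℕ w)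
  strict-source₂ v w u w≢u w≢v 1≤pw
    rewrite extend-toℕ (addOne u (remove w 1 (remove v 1 p))) w | extend-toℕ p w | addOne-≢ u (remove w 1 (remove v 1 p)) w≢u =
    ≤-reflexive (trans (remove-+ w 1 (remove v 1 p) (subst (1 ≤_) (sym pw≡) 1≤pw)) pw≡)
    where
    pw≡ : remove v 1 p w ≡ p w
    pw≡ = remove-≢ v 1 p w≢v

  strict-gains : ∀ v w u → GainsAtMostOneAt n (extend p) (extend (addOne u (remove w 1 (remove v 1 p)))) (toℕ u)
  strict-gains v w u = addOne-gains u _ (λ x → ≤-trans (remove-≤ w 1 _ x) (remove-≤ v 1 p x))

toStep : ∀ {n} {p r : Distribution n} → RubblingMove (PathGraph n) p r → Step n (extend p) (extend r)
toStep {n} {p} (pebbling v u (inj₁ 1+v≡u) 2≤pv) =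
  rightward (toℕ v) (subst (_< n) (sym 1+v≡u) (toℕ<n u)) (pebbling-source p v u (adjacent⇒≢ 1+v≡u) 2≤pv)
    (subst (GainsAtMostOneAt n _ _) (sym 1+v≡u) (addOne-gains p u _ (remove-≤ v 2 p)))
toStep {n} {p} (pebbling v u (inj₂ 1+u≡v) 2≤pv) =
  leftward (toℕ u) (subst (_< n) (sym 1+u≡v) (toℕ<n v))
    (subst (λ j → 2 + extend (addOne u (remove v 2 p)) j ≤ extend p j) (sym 1+u≡v) (pebbling-source p v u (≢-sym (adjacent⇒≢ 1+u≡v)) 2≤pv))
    (addOne-gains p u _ (remove-≤ v 2 p))
toStep (strict v w u v≢w (inj₁ 1+v≡u) (inj₁ 1+w≡u) _ _) = ⊥-elim (v≢w (toℕ-injective (suc-injective (trans 1+v≡u (sym 1+w≡u)))))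
toStep (strict v w u v≢w (inj₂ 1+u≡v) (inj₂ 1+u≡w) _ _) = ⊥-elim (v≢w (toℕ-injective (trans (sym 1+u≡v) 1+u≡w)))
toStep {n} {p} (strict v w u v≢w (inj₁ 1+v≡u) (inj₂ 1+u≡w) 1≤pv 1≤pw) =
  strict (toℕ v) (subst (_< n) (sym 2+v≡w) (toℕ<n w)) (strict-source₁ p v w u (adjacent⇒≢ 1+v≡u) 1≤pv)
    (subst (λ j → 1 + extend (addOne u (remove w 1 (remove v 1 p))) j ≤ extend p j) (sym 2+v≡w)
      (strict-source₂ p v w u (≢-sym (adjacent⇒≢ 1+u≡w)) (≢-sym v≢w) 1≤pw))
    (subst (GainsAtMostOneAt n _ _) (sym 1+v≡u) (strict-gains p v w u))
  where
  2+v≡w = trans (cong suc 1+v≡u) 1+u≡w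
toStep {n} {p} (strict v w u v≢w (inj₂ 1+u≡v) (inj₁ 1+w≡u) 1≤pv 1≤pw) =
  strict (toℕ w) (subst (_< n) (sym 2+w≡v) (toℕ<n v))
    (strict-source₂ p v w u (adjacent⇒≢ 1+w≡u) (≢-sym v≢w) 1≤pw)
    (subst (λ j → 1 + extend (addOne u (remove w 1 (remove v 1 p))) j ≤ extend p j) (sym 2+w≡v)
      (strict-source₁ p v w u (≢-sym (adjacent⇒≢ 1+u≡v)) 1≤pv))
    (subst (GainsAtMostOneAt n _ _) (sym 1+w≡u) (strict-gains p v w u))
  where
  2+w≡v = trans (cong suc 1+w≡u) 1+u≡v

covered-before-moves : ∀ {n} {p r : Distribution n} {x} → x < n → Star (RubblingMove (PathGraph n)) p r →
                       Covered n (extend r) x → Covered n (extend p) x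
covered-before-moves x<n ε          cov = cov
covered-before-moves x<n (m ◅ moves) cov = covered-backward (toStep m) x<n (covered-before-moves x<n moves cov)

reachable⇒covered : ∀ {n} {p : Distribution n} {k} → Reachable (PathGraph n) p k → Covered n (extend p) (toℕ k)
reachable⇒covered {k = k} (r , moves , 1≤rk) =
  covered-before-moves (toℕ<n k) moves (covered-by-pebble (subst (1 ≤_) (sym (extend-toℕ r k)) 1≤rk))

solvable⇒⌊2+n/2⌋≤size : ∀ {n} (p : Distribution n) → 1 ≤ n → AllReachable (PathGraph n) p → ⌊ suc (suc n) /2⌋ ≤ size p
solvable⇒⌊2+n/2⌋≤size {n} p 1≤n reach = begin
  ⌊ suc (suc n) /2⌋           ≤⟨ ⌊n/2⌋-mono (s≤s twice-size) ⟩
  ⌊ suc (size p + size p) /2⌋ ≡⟨ ⌊1+n+n/2⌋≡n (size p) ⟩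
  size p                      ∎
  where
  open ≤-Reasoning
  twice-size : suc n ≤ size p + size p
  twice-size rewrite size≡sumBelow p = all-covered⇒1+n≤size+size n (extend p) 1≤n (λ x x<n →
    subst (Covered n (extend p)) (toℕ-fromℕ< x<n) (reachable⇒covered (reach (fromℕ< x<n))))

spread : ∀ n → Distribution n
spread (suc zero)          _                     = 1
spread (suc (suc zero))    _                     = 1
spread (suc (suc (suc n))) Fin.zero              = 1
spread (suc (suc (suc n))) (Fin.suc Fin.zero)    = 0
spread (suc (suc (suc n))) (Fin.suc (Fin.suc k)) = spread (suc n) k

spread-first : ∀ n → spread (suc n) Fin.zero ≡ 1
spread-first zero          = refl
spread-first (suc zero)    = refl
spread-first (suc (suc n)) = refl

size-spread : ∀ n → size (spread (suc n)) ≡ ⌊ suc (suc (suc n)) /2⌋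
size-spread zero          = refl
size-spread (suc zero)    = refl
size-spread (suc (suc n)) = cong suc (size-spread n)

record Flanked {n} (p : Distribution n) (k : Fin n) : Set where
  field
    before after : Fin n
    before-adjacent : suc (toℕ before) ≡ toℕ k
    after-adjacent  : suc (toℕ k) ≡ toℕ after
    before-pebbled  : 1 ≤ p before
    after-pebbled   : 1 ≤ p after

spread-gap⇒flanked : ∀ n k → spread n k ≡ 0 → Flanked (spread n) k
spread-gap⇒flanked (suc (suc (suc n))) (Fin.suc Fin.zero) _ =
  record { before = Fin.zero ; after = Fin.suc (Fin.suc Fin.zero)
         ; before-adjacent = refl ; after-adjacent = refl
         ; before-pebbled = s≤s z≤n ; after-pebbled = ≤-reflexive (sym (spread-first n)) }
spread-gap⇒flanked (suc (suc (suc n))) (Fin.suc (Fin.suc k)) gap =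
  record { before = Fin.suc (Fin.suc before) ; after = Fin.suc (Fin.suc after)
         ; before-adjacent = cong (suc ∘ suc) before-adjacent ; after-adjacent = cong (suc ∘ suc) after-adjacent
         ; before-pebbled = before-pebbled ; after-pebbled = after-pebbled }
  where open Flanked (spread-gap⇒flanked (suc n) k gap)

flanked⇒reachable : ∀ {n} {p : Distribution n} {k} → Flanked p k → Reachable (PathGraph n) p k
flanked⇒reachable {k = k} f =
  _ , strict before after k before≢after (inj₁ before-adjacent) (inj₂ after-adjacent) before-pebbled after-pebbled ◅ ε
    , subst (1 ≤_) (sym (addOne-≡ k _)) (s≤s z≤n)
  where
  open Flanked f
  before≢after : before ≢ after
  before≢after refl = <⇒≢ (m<n⇒m<1+n (n<1+n _)) (sym (trans (cong suc after-adjacent) before-adjacent))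

spread-solvable : ∀ n → AllReachable (PathGraph n) (spread n)
spread-solvable n k with spread n k in pebbles
... | suc _ = spread n , ε , subst (1 ≤_) (sym pebbles) (s≤s z≤n)
... | zero  = flanked⇒reachable (spread-gap⇒flanked n k pebbles)

[n+1+1]/2≡⌊2+n/2⌋ : ∀ n → (n + 1 + 1) / 2 ≡ ⌊ suc (suc n) /2⌋
[n+1+1]/2≡⌊2+n/2⌋ n = trans (cong (_/ 2) (trans (+-assoc n 1 1) (+-comm n 2))) (sym (⌊n/2⌋≡n/2 (suc (suc n))))

mainTheorem16 : (n : ℕ) → 1 ≤ n →
    IsOptimalRubblingNumber (PathGraph n) ((n + 1 + 1) / 2)
mainTheorem16 (suc k) 1≤n rewrite [n+1+1]/2≡⌊2+n/2⌋ (suc k) =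
  (spread (suc k) , size-spread k , spread-solvable (suc k)) , λ p solvable → solvable⇒⌊2+n/2⌋≤size p 1≤n solvable
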